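{- Let $R\in\mathfrak{D}$ and $\mathfrak{D}'\subseteq\mathfrak{D}$, and let $\mathcal{E}(R)$ be the EV-system of $R$ with respect to $\mathfrak{D}'$. Then: - the map $\phi_R:\mathcal{E}_o(R)\to V(R)$, $\mathfrak{a}\mapsto\mathfrak{a}_1$, is a strict homomorphism from $\mathcal{E}(R)$ to $R$; - for every $G\in\mathfrak{D}'$ and $\xi\in\mathcal{S}(G,R)$, $\alpha^R_{G,\xi}$ is a strict homomorphism from $G$ to $\mathcal{E}(R)$ with $\phi_R\circ\alpha^R_{G,\xi}=\xi$ (that is, $\alpha^R$ is a simple S-scheme from $R$ to $\mathcal{E}(R)$ with respect to $\mathfrak{D}'$). If moreover $\mathcal{E}(R)\in\mathfrak{D}'$, then $\alpha^R_{\mathcal{E}(R),\phi_R}(\mathfrak{a})_2\subseteq\mathfrak{a}_2$ and $\alpha^R_{\mathcal{E}(R),\phi_R}(\mathfrak{a})_3\subseteq\mathfrak{a}_3$ for all $\mathfrak{a}\in\mathcal{E}_o(R)$.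
   Context: Digraphs $G=(V(G),A(G))$ have a finite nonempty vertex set, and $A(G)\subseteq V(G)\times V(G)$; loops are allowed. $N^{in}_G(v)=\{w\ne v:wv\in A(G)\}$ and $N^{out}_G(v)=\{w\ne v:vw\in A(G)\}$. A homomorphism maps arcs to arcs; it is strict if, in addition, it maps proper arcs ($v\ne w$) to proper arcs. $\mathcal{S}(G,H)$ is the set of strict homomorphisms. $\mathfrak{D}$ is a representative system of the isomorphism classes of finite digraphs; constructed digraphs are identified with their representatives. EV-system of $R$ with respect to $\mathfrak{D}'$: - Vertex set $\mathcal{E}_o(R)=\{(v,D,U):v\in V(R),\ D\subseteq N^{in}_R(v),\ U\subseteq N^{out}_R(v)\}$, with components $\mathfrak{a}_1,\mathfrak{a}_2,\mathfrak{a}_3$. - $\alpha^R_{G,\xi}(v)=(\xi(v),\xi[N^{in}_G(v)],\xi[N^{out}_G(v)])$ for $G\in\mathfrak{D}'$ and $\xi\in\mathcal{S}(G,R)$. - $\mathfrak{a}\mathfrak{b}\in A(\mathcal{E}(R))$ iff there exist $G\in\mathfrak{D}'$, $\xi\in\mathcal{S}(G,R)$ and $vw\in A(G)$ with $\mathfrak{a}=\alpha^R_{G,\xi}(v)$ and $\mathfrak{b}=\alpha^R_{G,\xi}(w)$. -}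

module Defs where

open import Level using (Level; _⊔_)
open import Data.Bool using (Bool; true; false; not; _∧_; T)
open import Data.Bool.Properties using (T-∧; T-not-≡)
open import Data.Nat using (ℕ)
open import Data.Fin using (Fin; _≟_)
open import Data.Fin.Properties using (any?)
open import Data.Fin.Subset using (Subset; _∈_; _⊆_; inside)
open import Data.Fin.Subset.Properties using (_∈?_)
open import Data.Vec using (tabulate; lookup)
open import Data.Vec.Properties using (lookup∘tabulate; []=⇒lookup)
open import Data.Product using (Σ; Σ-syntax; ∃; _×_; _,_; proj₁; proj₂)
open import Data.Empty using (⊥-elim)
open import Relation.Nullary using (¬_; Dec; yes; no; does; _×-dec_)
open import Relation.Nullary.Decidable using (⌊_⌋; toWitness)
open import Relation.Binary.PropositionalEquality using (_≡_; _≢_; refl; sym; trans; subst)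
open import Function.Bundles using (_↔_; _⇔_)

record Digraph : Set where
  field
    n   : ℕ
    adj : Fin n → Fin n → Bool

open Digraph public

Arc : (G : Digraph) → Fin (n G) → Fin (n G) → Set
Arc G v w = adj G v w ≡ true

IsStrictHomRel : ∀ {a b ℓ₁ ℓ₂} {X : Set a} {Y : Set b} →
                 (X → X → Set ℓ₁) → (Y → Y → Set ℓ₂) → (X → Y) → Set (a ⊔ b ⊔ ℓ₁ ⊔ ℓ₂)
IsStrictHomRel {X = X} A B f =
  ∀ {x y : X} → A x y → B (f x) (f y) × (x ≢ y → f x ≢ f y)

IsStrict : (G R : Digraph) → (Fin (n G) → Fin (n R)) → Set
IsStrict G R ξ = IsStrictHomRel (Arc G) (Arc R) ξ

Nin : (G : Digraph) → Fin (n G) → Subset (n G)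
Nin G v = tabulate λ u → not ⌊ u ≟ v ⌋ ∧ adj G u v

Nout : (G : Digraph) → Fin (n G) → Subset (n G)
Nout G v = tabulate λ u → not ⌊ v ≟ u ⌋ ∧ adj G v u

image : ∀ {m k} → (Fin m → Fin k) → Subset m → Subset k
image {m} ξ S = tabulate λ u → ⌊ any? (λ w → (w ∈? S) ×-dec (ξ w ≟ u)) ⌋

private
  mem-tab : ∀ {k} (f : Fin k → Bool) {x} → x ∈ tabulate f → f x ≡ true
  mem-tab f {x} p = trans (sym (lookup∘tabulate f x)) ([]=⇒lookup p)

  tab-mem : ∀ {k} (f : Fin k → Bool) {x} → f x ≡ true → x ∈ tabulate f
  tab-mem f {x} p = Data.Vec.Properties.lookup⇒[]= x (tabulate f)
                      (trans (lookup∘tabulate f x) p)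

  ∧-split : ∀ {a b} → a ∧ b ≡ true → a ≡ true × b ≡ true
  ∧-split {true} {true} refl = refl , refl

  ∧-join : ∀ {a b} → a ≡ true → b ≡ true → a ∧ b ≡ true
  ∧-join refl refl = refl

  not-dec : ∀ {k} {x y : Fin k} → not ⌊ x ≟ y ⌋ ≡ true → x ≢ y
  not-dec {x = x} {y} p with x ≟ y
  not-dec {x = x} {y} () | yes _
  not-dec {x = x} {y} p  | no ne = ne

  dec-not : ∀ {k} {x y : Fin k} → x ≢ y → not ⌊ x ≟ y ⌋ ≡ true
  dec-not {x = x} {y} ne with x ≟ y
  ... | yes eq = ⊥-elim (ne eq)
  ... | no _ = refl

  any-true : ∀ {k} {P : Fin k → Set} (P? : ∀ w → Dec (P w)) → ⌊ any? P? ⌋ ≡ true → ∃ P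
  any-true P? p with any? P?
  ... | yes q = q

image-in : ∀ (G R : Digraph) (ξ : Fin (n G) → Fin (n R)) → IsStrict G R ξ →
           ∀ v → image ξ (Nin G v) ⊆ Nin R (ξ v)
image-in G R ξ h v {x} p with any-true _ (mem-tab _ p)
... | w , (w∈ , refl) with ∧-split (mem-tab _ w∈)
... | nd , a = tab-mem _ (∧-join (dec-not (proj₂ (h a) (not-dec nd))) (proj₁ (h a)))

image-out : ∀ (G R : Digraph) (ξ : Fin (n G) → Fin (n R)) → IsStrict G R ξ →
            ∀ v → image ξ (Nout G v) ⊆ Nout R (ξ v)
image-out G R ξ h v {x} p with any-true _ (mem-tab _ p)
... | w , (w∈ , refl) with ∧-split (mem-tab _ w∈)
... | nd , a = tab-mem _ (∧-join (dec-not (proj₂ (h a) (not-dec nd))) (proj₁ (h a)))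

-- The subset conditions are irrelevant fields, so elements are determined
-- by (v, D, U), as for the set of triples in the paper.

record EV (R : Digraph) : Set where
  constructor ev
  field
    a₁ : Fin (n R)
    a₂ : Subset (n R)
    a₃ : Subset (n R)
    .a₂⊆ : a₂ ⊆ Nin R a₁
    .a₃⊆ : a₃ ⊆ Nout R a₁

open EV public

φ : (R : Digraph) → EV R → Fin (n R)
φ R 𝔞 = a₁ 𝔞

α : (R G : Digraph) (ξ : Fin (n G) → Fin (n R)) → .(IsStrict G R ξ) → Fin (n G) → EV R
α R G ξ h v = ev (ξ v) (image ξ (Nin G v)) (image ξ (Nout G v))
                 (image-in G R ξ h v) (image-out G R ξ h v)

EArc : (R : Digraph) (𝔇' : Digraph → Set) → EV R → EV R → Set
EArc R 𝔇' 𝔞 𝔟 =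
  Σ[ G ∈ Digraph ] 𝔇' G ×
  Σ[ ξ ∈ (Fin (n G) → Fin (n R)) ] Σ[ h ∈ IsStrict G R ξ ]
  Σ[ v ∈ Fin (n G) ] Σ[ w ∈ Fin (n G) ]
    (Arc G v w × α R G ξ h v ≡ 𝔞 × α R G ξ h w ≡ 𝔟)

-- G is isomorphic to ℰ(R) via ψ (used to express "ℰ(R) ∈ 𝔇'", since
-- constructed digraphs are identified with their representatives).
IsEVIso : (R : Digraph) (𝔇' : Digraph → Set) (G : Digraph) → (Fin (n G) ↔ EV R) → Set
IsEVIso R 𝔇' G ψ = ∀ x y → Arc G x y ⇔ EArc R 𝔇' (Inverse.to ψ x) (Inverse.to ψ y)
  where open Function.Bundles using (Inverse)

-- A strict homomorphism ξ : G → R is injective along every arc, so an arc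
-- α(v) α(w) of ℰ(R) is proper only if v w is a proper arc of G; then ξ v lies in
-- the in-part of α(w) and ξ w in the out-part of α(v). For the inclusions, a
-- neighbour of 𝔞 in G ≅ ℰ(R) is joined to 𝔞 by a proper arc of ℰ(R), so its
-- first component already lies in the corresponding part of 𝔞.
module Submission where

open import Defs
open import Data.Bool using (Bool; T)
open import Data.Empty using (⊥-elim)
open import Data.Nat using (ℕ)
open import Data.Bool.Properties using (T-≡; T-∧)
open import Data.Fin using (Fin; _≟_)
open import Data.Fin.Subset using (Subset; _∈_; _⊆_)
open import Data.Product using (∃; _×_; _,_; proj₁; proj₂)
open import Data.Vec using (tabulate)
open import Data.Vec.Properties using (lookup∘tabulate; []=⇒lookup; lookup⇒[]=)
open import Function using (_∘_)
open import Function.Bundles using (_↔_; _⇔_; Inverse; Injection; Equivalence; mk⇔)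
open import Function.Definitions using (Injective)
open import Function.Properties.Inverse using (Inverse⇒Injection)
open import Relation.Nullary using (yes; no)
open import Relation.Nullary.Decidable
  using (toWitness; fromWitness; toWitnessFalse; fromWitnessFalse)
open import Relation.Binary.PropositionalEquality
  using (_≡_; _≢_; refl; sym; trans; cong; subst)

private
  variable
    k m : ℕ

∈tabulate⇔ : {f : Fin k → Bool} {x : Fin k} → x ∈ tabulate f ⇔ T (f x)
∈tabulate⇔ {f = f} {x} = mk⇔
  (λ x∈ → Equivalence.from T-≡ (trans (sym (lookup∘tabulate f x)) ([]=⇒lookup x∈)))
  (λ fx → lookup⇒[]= x (tabulate f) (trans (lookup∘tabulate f x) (Equivalence.to T-≡ fx)))

∈Nin⇔ : (G : Digraph) {u v : Fin (n G)} → u ∈ Nin G v ⇔ (u ≢ v × Arc G u v)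
∈Nin⇔ G = mk⇔
  (λ u∈ → let (u≢v , uv) = Equivalence.to T-∧ (Equivalence.to ∈tabulate⇔ u∈)
          in toWitnessFalse u≢v , Equivalence.to T-≡ uv)
  (λ (u≢v , uv) → Equivalence.from ∈tabulate⇔
     (Equivalence.from T-∧ (fromWitnessFalse u≢v , Equivalence.from T-≡ uv)))

∈Nout⇔ : (G : Digraph) {u v : Fin (n G)} → v ∈ Nout G u ⇔ (u ≢ v × Arc G u v)
∈Nout⇔ G = mk⇔
  (λ v∈ → let (u≢v , uv) = Equivalence.to T-∧ (Equivalence.to ∈tabulate⇔ v∈)
          in toWitnessFalse u≢v , Equivalence.to T-≡ uv)
  (λ (u≢v , uv) → Equivalence.from ∈tabulate⇔
     (Equivalence.from T-∧ (fromWitnessFalse u≢v , Equivalence.from T-≡ uv)))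

∈image⁻ : (ξ : Fin m → Fin k) (S : Subset m) {u : Fin k} →
          u ∈ image ξ S → ∃ λ w → w ∈ S × ξ w ≡ u
∈image⁻ ξ S u∈ = toWitness (Equivalence.to ∈tabulate⇔ u∈)

∈image⁺ : (ξ : Fin m → Fin k) (S : Subset m) {w : Fin m} → w ∈ S → ξ w ∈ image ξ S
∈image⁺ ξ S {w} w∈ = Equivalence.from ∈tabulate⇔ (fromWitness (w , w∈ , refl))

strict⇒injective-on-arcs : {G R : Digraph} {ξ : Fin (n G) → Fin (n R)} → IsStrict G R ξ →
                          ∀ {v w} → Arc G v w → ξ v ≡ ξ w → v ≡ w
strict⇒injective-on-arcs ξ-strict {v} {w} vw ξv≡ξw with v ≟ w
... | yes v≡w = v≡w
... | no v≢w = ⊥-elim (proj₂ (ξ-strict vw) v≢w ξv≡ξw)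

module _ (R : Digraph) (𝔇' : Digraph → Set) where

  φ-strict : IsStrictHomRel (EArc R 𝔇') (Arc R) (φ R)
  φ-strict (G , _ , ξ , ξ-strict , v , w , vw , refl , refl) =
    proj₁ (ξ-strict vw) ,
    λ αv≢αw ξv≡ξw → αv≢αw (cong (α R G ξ ξ-strict) (strict⇒injective-on-arcs {R = R} ξ-strict vw ξv≡ξw))

  α-strict : (G : Digraph) → 𝔇' G → (ξ : Fin (n G) → Fin (n R)) (ξ-strict : IsStrict G R ξ) →
             IsStrictHomRel (Arc G) (EArc R 𝔇') (α R G ξ ξ-strict)
  α-strict G G∈𝔇' ξ ξ-strict {v} {w} vw =
    (G , G∈𝔇' , ξ , ξ-strict , v , w , vw , refl , refl) ,
    λ v≢w αv≡αw → proj₂ (ξ-strict vw) v≢w (cong a₁ αv≡αw)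

  EArc-proper⇒∈ : ∀ {𝔞 𝔟} → EArc R 𝔇' 𝔞 𝔟 → 𝔞 ≢ 𝔟 → a₁ 𝔞 ∈ a₂ 𝔟 × a₁ 𝔟 ∈ a₃ 𝔞
  EArc-proper⇒∈ (G , _ , ξ , ξ-strict , v , w , vw , refl , refl) αv≢αw =
    ∈image⁺ ξ (Nin G w) (Equivalence.from (∈Nin⇔ G) (v≢w , vw)) ,
    ∈image⁺ ξ (Nout G v) (Equivalence.from (∈Nout⇔ G) (v≢w , vw))
    where
    v≢w : v ≢ w
    v≢w v≡w = αv≢αw (cong (α R G ξ ξ-strict) v≡w)

  α-of-embedding-⊆ : (G : Digraph) (ψ : Fin (n G) → EV R) → Injective _≡_ _≡_ ψ →
                     (∀ {x y} → Arc G x y → EArc R 𝔇' (ψ x) (ψ y)) →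
                     (h : IsStrict G R (φ R ∘ ψ)) (x : Fin (n G)) →
                     a₂ (α R G (φ R ∘ ψ) h x) ⊆ a₂ (ψ x) × a₃ (α R G (φ R ∘ ψ) h x) ⊆ a₃ (ψ x)
  α-of-embedding-⊆ G ψ ψ-injective ψ-hom h x = in⊆ , out⊆
    where
    in⊆ : a₂ (α R G (φ R ∘ ψ) h x) ⊆ a₂ (ψ x)
    in⊆ u∈ with ∈image⁻ (φ R ∘ ψ) (Nin G x) u∈
    ... | w , w∈ , refl =
      let (w≢x , wx) = Equivalence.to (∈Nin⇔ G) w∈
      in proj₁ (EArc-proper⇒∈ (ψ-hom wx) (w≢x ∘ ψ-injective))
    out⊆ : a₃ (α R G (φ R ∘ ψ) h x) ⊆ a₃ (ψ x)
    out⊆ u∈ with ∈image⁻ (φ R ∘ ψ) (Nout G x) u∈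
    ... | w , w∈ , refl =
      let (x≢w , xw) = Equivalence.to (∈Nout⇔ G) w∈
      in proj₂ (EArc-proper⇒∈ (ψ-hom xw) (x≢w ∘ ψ-injective))

lemma2 : (R : Digraph) (𝔇' : Digraph → Set) →
    IsStrictHomRel (EArc R 𝔇') (Arc R) (φ R)
    × (∀ (G : Digraph) → 𝔇' G → (ξ : Fin (n G) → Fin (n R)) → (h : IsStrict G R ξ) →
         IsStrictHomRel (Arc G) (EArc R 𝔇') (α R G ξ h)
         × (∀ v → φ R (α R G ξ h v) ≡ ξ v))
    × (∀ (G : Digraph) → 𝔇' G → (ψ : Fin (n G) ↔ EV R) → IsEVIso R 𝔇' G ψ →
         (h : IsStrict G R (φ R ∘ Inverse.to ψ)) → (𝔞 : EV R) →
         (a₂ (α R G (φ R ∘ Inverse.to ψ) h (Inverse.from ψ 𝔞)) ⊆ a₂ 𝔞)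
         × (a₃ (α R G (φ R ∘ Inverse.to ψ) h (Inverse.from ψ 𝔞)) ⊆ a₃ 𝔞))
lemma2 R 𝔇' =
  φ-strict R 𝔇' ,
  (λ G G∈𝔇' ξ ξ-strict → α-strict R 𝔇' G G∈𝔇' ξ ξ-strict , λ _ → refl) ,
  λ G _ ψ ψ-iso h 𝔞 →
    subst (λ 𝔟 → a₂ (α R G (φ R ∘ Inverse.to ψ) h (Inverse.from ψ 𝔞)) ⊆ a₂ 𝔟
                 × a₃ (α R G (φ R ∘ Inverse.to ψ) h (Inverse.from ψ 𝔞)) ⊆ a₃ 𝔟)
          (Inverse.strictlyInverseˡ ψ 𝔞)
          (α-of-embedding-⊆ R 𝔇' G (Inverse.to ψ) (Injection.injective (Inverse⇒Injection ψ))
             (λ {x} {y} → Equivalence.to (ψ-iso x y)) h (Inverse.from ψ 𝔞))
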